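{- Let $G=(V,E)$ be a graph and let $\mathcal{P}=(V_{u,v}\mid (u,v)\in V\times V)$ be a simple T-partition system on $G$. Then the groupoid associated with $\mathcal{P}$ is a simple travel groupoid on $G$.
   Context: Graphs are undirected, possibly infinite, with no loops and no multiple edges. For $u\in V$, $N_G[u]=\{u\}\cup\{v\mid\{u,v\}\in E\}$. A T-partition system on $G$ is a family $(V_{u,v}\subseteq V\mid (u,v)\in V\times V)$ such that: (P0) for every $u$, $\{V_{u,v}\mid v\in N_G[u]\}$ is a partition of $V$; (P1a) $V_{u,u}=\{u\}$; (P1b) for $u\neq v$: $v\in V_{u,v}$ iff $\{u,v\}\in E$; (P1c) for $u\neq v$: $V_{u,v}=\emptyset$ iff $\{u,v\}\notin E$; (P2) for $u\neq v$: $V_{u,v}\cap V_{v,u}=\emptyset$. It is simple if (R3): for all $u,v,x,y\in V$, if $u\in V_{v,x}$, $v\in V_{u,y}$, $u\neq x$, $v\neq y$, then $x\in V_{u,y}$ and $y\in V_{v,x}$. The groupoid associated with a T-partition system is $(V,*)$ where $u*v$ is the unique $w$ with $v\in V_{u,w}$. A travel groupoid is a nonempty set $V$ with binary operation $*$ satisfying (t1) $(u*v)*u=u$ for all $u,v$ and (t2) if $(u*v)*v=u$ then $u=v$; it is on $G$ if $V(G)=V$ and $E(G)=\{\{u,v\}\mid u\neq v,\ u*v=v\}$; it is simple if for all $u,v$, $v*u\neq u$ implies $u*(v*u)=u*v$. -}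

module Defs where

open import Data.Product using (Σ; _×_; _,_; proj₁; ∃!)
open import Data.Sum using (_⊎_)
open import Data.Empty using (⊥)
open import Relation.Nullary using (¬_)
open import Relation.Binary.PropositionalEquality using (_≡_; _≢_)
open import Function.Bundles using (_⇔_)

-- An undirected graph without loops / multiple edges, possibly infinite:
-- a vertex type V with a symmetric irreflexive adjacency relation E.
-- (E u v  represents  {u,v} ∈ E.)
record Graph : Set₁ where
  field
    V     : Set
    vtx   : V          -- vertex set is nonempty (standard convention)
    E     : V → V → Set
    sym   : ∀ {u v} → E u v → E v u
    irrefl : ∀ {u} → ¬ E u u

_∈N[_] : {G : Graph} → Graph.V G → Graph.V G → Set
_∈N[_] {G} v u = (v ≡ u) ⊎ Graph.E G u v

-- A T-partition system on G.  Sub u v x  means  x ∈ V_{u,v}.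
record TPartitionSystem (G : Graph) : Set₁ where
  open Graph G
  field
    Sub : V → V → V → Set
    -- (P0) {V_{u,v} | v ∈ N[u]} is a partition of V (indexed by v ∈ N[u]):
    --      every x lies in V_{u,v} for exactly one v ∈ N[u]
    P0  : ∀ u x → ∃! _≡_ (λ v → (_∈N[_] {G} v u) × Sub u v x)
    P1a : ∀ u x → Sub u u x ⇔ (x ≡ u)
    P1b : ∀ u v → u ≢ v → (Sub u v v ⇔ E u v)
    P1c : ∀ u v → u ≢ v → ((∀ x → ¬ Sub u v x) ⇔ (¬ E u v))
    P2  : ∀ u v → u ≢ v → ∀ x → ¬ (Sub u v x × Sub v u x)

IsSimpleTPS : {G : Graph} → TPartitionSystem G → Set
IsSimpleTPS {G} P = ∀ u v x y → Sub v x u → Sub u y v → u ≢ x → v ≢ y →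
                    Sub u y x × Sub v x y
  where open Graph G
        open TPartitionSystem P

-- The groupoid associated with P: u * v = the unique w with v ∈ V_{u,w}
-- (w ∈ N[u], as given by (P0)).
assocOp : {G : Graph} → TPartitionSystem G →
          Graph.V G → Graph.V G → Graph.V G
assocOp P u v = proj₁ (TPartitionSystem.P0 P u v)

IsTravelGroupoid : (V : Set) → (V → V → V) → Set
IsTravelGroupoid V _*_ =
  V ×                                         -- V nonempty
  (∀ u v → (u * v) * u ≡ u) ×
  (∀ u v → (u * v) * v ≡ u → u ≡ v)

-- E(G) = { {u,v} | u ≠ v, u * v = v }  (as a set of unordered pairs)
IsOn : (G : Graph) → (Graph.V G → Graph.V G → Graph.V G) → Set
IsOn G _*_ = ∀ a b → Graph.E G a b ⇔
             (a ≢ b × ((a * b ≡ b) ⊎ (b * a ≡ a)))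

IsSimpleGroupoid : (V : Set) → (V → V → V) → Set
IsSimpleGroupoid V _*_ = ∀ u v → v * u ≢ u → u * (v * u) ≡ u * v

IsSimpleTravelGroupoidOn : (G : Graph) → (Graph.V G → Graph.V G → Graph.V G) → Set
IsSimpleTravelGroupoidOn G _*_ =
  IsTravelGroupoid (Graph.V G) _*_ × IsOn G _*_ × IsSimpleGroupoid (Graph.V G) _*_

module Submission where

-- Write u * v for the unique w ∈ N[u] with v ∈ V_{u,w} (given by (P0)).
-- Everything follows from two elementary facts about this operation:
--   * u * v lies in N[u] and v ∈ V_{u, u * v}, and these characterise u * v;
--   * for a neighbour w ∈ N[u] we have u * w = w (by (P1a)/(P1b)).
-- Since closed neighbourhoods are symmetric, (t1) follows from the second
-- fact applied to w = u * v.  For (t2), if w = u * v ≠ u then (u * v) * v = u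
-- would put v in both V_{u,w} and V_{w,u}, contradicting (P2), while
-- w = u gives v ∈ V_{u,u} = {u}.  The edge set is recovered because
-- u * v = v with u ≠ v forces v ∈ N[u] \ {u}.
-- Finally simplicity of the groupoid is (R3) applied with x = v * u and
-- y = u * v, after checking its side conditions with (t1).

open import Defs
open import Data.Product using (_,_; proj₁; proj₂)
open import Data.Sum using (inj₁; inj₂)
open import Data.Empty using (⊥-elim)
open import Relation.Binary.PropositionalEquality
open import Function.Base using (_∘_)
open import Function.Bundles using (Equivalence; mk⇔)

module AssociatedGroupoid (G : Graph) (P : TPartitionSystem G) where
  open Graph G renaming (sym to E-sym)
  open TPartitionSystem P

  infixl 7 _*_
  _*_ : V → V → V
  _*_ = assocOp P

  infix 4 _∈N[_]′
  _∈N[_]′ : V → V → Set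
  v ∈N[ u ]′ = _∈N[_] {G} v u

  E⇒≢ : ∀ {u v} → E u v → u ≢ v
  E⇒≢ e refl = irrefl e

  N-sym : ∀ {u w} → w ∈N[ u ]′ → u ∈N[ w ]′
  N-sym (inj₁ w≡u) = inj₁ (sym w≡u)
  N-sym (inj₂ e)   = inj₂ (E-sym e)

  *-∈N : ∀ u v → u * v ∈N[ u ]′
  *-∈N u v = proj₁ (proj₁ (proj₂ (P0 u v)))

  *-Sub : ∀ u v → Sub u (u * v) v
  *-Sub u v = proj₂ (proj₁ (proj₂ (P0 u v)))

  *-unique : ∀ {u v w} → w ∈N[ u ]′ → Sub u w v → u * v ≡ w
  *-unique {u} {v} w∈N s = proj₂ (proj₂ (P0 u v)) (w∈N , s)

  *-neighbour : ∀ {u w} → w ∈N[ u ]′ → u * w ≡ w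
  *-neighbour {u} (inj₁ refl) = *-unique (inj₁ refl) (Equivalence.from (P1a u u) refl)
  *-neighbour {u} {w} (inj₂ e) = *-unique (inj₂ e) (Equivalence.from (P1b u w (E⇒≢ e)) e)

  t1 : ∀ u v → (u * v) * u ≡ u
  t1 u v = *-neighbour (N-sym (*-∈N u v))

  -- A step w ∈ N[u] towards v (v ∈ V_{u,w}) can only be undone from v's
  -- side (w * v = u) when v = u: otherwise w ≠ u, and v would lie in
  -- V_{u,w} ∩ V_{w,u}, which (P2) forbids.
  return-forces-≡ : ∀ {u v w} → w ∈N[ u ]′ → Sub u w v → w * v ≡ u → u ≡ v
  return-forces-≡ {u} {v} (inj₁ refl) s _ = sym (Equivalence.to (P1a u v) s)
  return-forces-≡ {u} {v} {w} (inj₂ e) s back =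
    ⊥-elim (P2 u w (E⇒≢ e) v (s , subst (λ z → Sub w z v) back (*-Sub w v)))

  t2 : ∀ u v → (u * v) * v ≡ u → u ≡ v
  t2 u v = return-forces-≡ (*-∈N u v) (*-Sub u v)

  *-arrives⇒E : ∀ {u v} → u ≢ v → u * v ≡ v → E u v
  *-arrives⇒E {u} {v} u≢v arrives with subst (_∈N[ u ]′) arrives (*-∈N u v)
  ... | inj₁ v≡u = ⊥-elim (u≢v (sym v≡u))
  ... | inj₂ e   = e

  isOn : IsOn G _*_
  isOn u v = mk⇔
    (λ e → E⇒≢ e , inj₁ (*-neighbour (inj₂ e)))
    (λ { (u≢v , inj₁ arrives) → *-arrives⇒E u≢v arrives
       ; (u≢v , inj₂ arrives) → E-sym (*-arrives⇒E (u≢v ∘ sym) arrives) })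

  -- Simplicity: (R3) with x = v * u and y = u * v gives v * u ∈ V_{u, u * v},
  -- hence u * (v * u) = u * v.  Its side condition v ≠ u * v holds because
  -- u * v = v would give v * u = (u * v) * u = u by (t1).
  simple : IsSimpleTPS P → IsSimpleGroupoid V _*_
  simple R3 u v vu≢u = *-unique (*-∈N u v) (proj₁ (R3 u v (v * u) (u * v)
      (*-Sub v u) (*-Sub u v) (λ u≡vu → vu≢u (sym u≡vu)) v≢uv))
    where
      v≢uv : v ≢ u * v
      v≢uv v≡uv = vu≢u (subst (λ z → z * u ≡ u) (sym v≡uv) (t1 u v))

lemma4p3 : (G : Graph) (P : TPartitionSystem G) → IsSimpleTPS P →
           IsSimpleTravelGroupoidOn G (assocOp P)
lemma4p3 G P R3 = (Graph.vtx G , t1 , t2) , isOn , simple R3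
  where open AssociatedGroupoid G P
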